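{- Let $f:2^{\mathcal{N}}\to\mathbb{Z}_{\ge0}$ be a polymatroid with $f(\{e\})>0$ for every $e\in\mathcal{N}$, and let $\mathcal{N}=S_0\supseteq S_1\supseteq\dots\supseteq S_w=\emptyset$ be a strength decomposition of $\mathcal{N}$ with respect to $f$. Then $S_i$ is a closed set of $f$ for every $i\in[0,w]$.
   Context: A polymatroid is an integer-valued, monotone, submodular set function with value $0$ on the empty set. $\mathrm{span}(S)=\{e\in\mathcal{N}: f(S\cup\{e\})=f(S)\}$; $S$ is closed if $\mathrm{span}(S)=S$. For $T\subseteq S$, $\varphi(T|S)=\frac{|S|-|T|}{f(S)-f(T)}$ with $x/0=+\infty$. A strength decomposition of $\mathcal{N}$ with respect to $f$ is a sequence $S_0\supseteq\dots\supseteq S_w$ with $S_0=\mathcal{N}$; $S_w=\emptyset$ and $S_i\neq\emptyset$ for $i<w$; each $S_i$ ($i\in[w]$) minimizes $\varphi(S|S_{i-1})$ over $S\subseteq S_{i-1}$; and $\varphi(S_i|S_{i-1})$ is nondecreasing in $i$. -}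

module Defs where

open import Data.Nat using (ℕ; zero; suc; _+_; _*_; _∸_; _≤_; _<_)
open import Data.Fin using (Fin)
open import Data.Fin.Subset using (Subset; _⊆_; _∪_; _∩_; ⁅_⁆; ∣_∣; ⊥; ⊤; _∈_; Nonempty)
open import Data.Product using (_×_)
open import Relation.Binary.PropositionalEquality using (_≡_)
open import Relation.Nullary using (¬_)
open import Data.Sum using (_⊎_)
open import Function.Bundles using (_⇔_)

SetFn : ℕ → Set
SetFn n = Subset n → ℕ

record IsPolymatroid {n : ℕ} (f : SetFn n) : Set where
  field
    empty0     : f ⊥ ≡ 0
    monotone   : ∀ {S T : Subset n} → S ⊆ T → f S ≤ f T
    submodular : ∀ (S T : Subset n) → f (S ∪ T) + f (S ∩ T) ≤ f S + f T

InSpan : ∀ {n} → SetFn n → Subset n → Fin n → Set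
InSpan f S e = f (S ∪ ⁅ e ⁆) ≡ f S

Closed : ∀ {n} → SetFn n → Subset n → Set
Closed f S = ∀ e → (InSpan f S e ⇔ (e ∈ S))

-- Extended-nonnegative-rational fractions a/b with a/0 = +∞, compared exactly:
-- a/b ≤ c/d  iff  d = 0 (rhs is +∞), or b ≠ 0 and a*d ≤ c*b.
FracLe : ℕ → ℕ → ℕ → ℕ → Set
FracLe a b c d = (d ≡ 0) ⊎ ((¬ (b ≡ 0)) × (a * d ≤ c * b))

-- φ(T|S) ≤ φ(T'|S'), where φ(T|S) = (|S| - |T|)/(f S - f T).
-- (Only used with T ⊆ S, so the truncated subtractions are exact.)
φ≤ : ∀ {n} → SetFn n → Subset n → Subset n → Subset n → Subset n → Set
φ≤ f T S T' S' = FracLe (∣ S ∣ ∸ ∣ T ∣) (f S ∸ f T) (∣ S' ∣ ∸ ∣ T' ∣) (f S' ∸ f T')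

-- Strength decomposition S 0 ⊇ S 1 ⊇ … ⊇ S w, given as a sequence ℕ → Subset n
-- of which only indices 0..w are relevant.
record IsStrengthDecomposition {n : ℕ} (f : SetFn n) (w : ℕ) (S : ℕ → Subset n) : Set where
  field
    first    : S 0 ≡ ⊤
    last     : S w ≡ ⊥
    nonempty : ∀ i → i < w → Nonempty (S i)
    -- for i ∈ [w] (i = suc j, j < w): S i ⊆ S (i-1) and S i minimizes φ(· | S (i-1))
    sub      : ∀ j → j < w → S (suc j) ⊆ S j
    minimal  : ∀ j → j < w → ∀ (T : Subset n) → T ⊆ S j → φ≤ f (S (suc j)) (S j) T (S j)
    nondecr  : ∀ j → suc j < w → φ≤ f (S (suc j)) (S j) (S (suc (suc j))) (S (suc j))

-- Inside S_{j-1}, adding to S_j an element e ∈ S_{j-1} ∖ S_j that S_j spans keeps the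
-- rank drop f(S_{j-1}) − f(S_j) but shrinks the size difference, so it would give a
-- strictly smaller φ(· | S_{j-1}) than the minimiser S_j. Hence S_j spans nothing of
-- S_{j-1} ∖ S_j, and since span is monotone (submodularity), induction down the chain
-- from S_0 = N shows S_j spans nothing outside itself.
module Submission where

open import Defs
open import Data.Nat using (ℕ; zero; suc; _+_; _*_; _∸_; _≤_; _<_; ≢-nonZero)
open import Data.Nat.Properties
  using (≤-antisym; <⇒≤; <⇒≱; +-mono-≤; +-cancelʳ-≤; *-cancelʳ-≤; ∸-monoʳ-<; module ≤-Reasoning)
open import Data.Fin using (Fin)
open import Data.Fin.Subset using (Subset; _⊆_; _⊂_; _∪_; _∩_; ⁅_⁆; ∣_∣; _∈_; _∉_; ⊥)
open import Data.Fin.Subset.Properties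
  using (_∈?_; p⊆p∪q; q⊆p∪q; x∈p∪q⁻; x∈p∩q⁺; x∈⁅x⁆; x∈⁅y⁆⇒x≡y; ∈⊤; ⊥⊆; ⊆-refl; p⊆q⇒∣p∣≤∣q∣; p⊂q⇒∣p∣<∣q∣)
open import Data.Product using (_,_)
open import Data.Sum using (inj₁; inj₂; [_,_])
open import Data.Empty using (⊥-elim)
open import Relation.Binary.PropositionalEquality using (_≡_; _≢_; sym; cong; subst)
open import Relation.Nullary using (¬_; yes; no)
open import Function.Bundles using (mk⇔)

private
  variable
    n : ℕ
    p q r : Subset n
    x : Fin n

∪-least : p ⊆ r → q ⊆ r → p ∪ q ⊆ r
∪-least {p = p} {q = q} p⊆r q⊆r x∈ = [ p⊆r , q⊆r ] (x∈p∪q⁻ p q x∈)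

x∈p⇒⁅x⁆⊆p : x ∈ p → ⁅ x ⁆ ⊆ p
x∈p⇒⁅x⁆⊆p {x = x} x∈p y∈⁅x⁆ = subst (_∈ _) (sym (x∈⁅y⁆⇒x≡y x y∈⁅x⁆)) x∈p

φ≰-equal-rank-superset : ∀ (f : SetFn n) {A B T : Subset n} → B ⊂ T → T ⊆ A → f T ≡ f B
                       → f A ∸ f B ≢ 0 → ¬ φ≤ f B A T A
φ≰-equal-rank-superset f {A} {B} {T} B⊂T T⊆A fT≡fB drop≢0 = contradict
  where
    smaller : ∣ A ∣ ∸ ∣ T ∣ < ∣ A ∣ ∸ ∣ B ∣
    smaller = ∸-monoʳ-< (p⊂q⇒∣p∣<∣q∣ B⊂T) (p⊆q⇒∣p∣≤∣q∣ T⊆A)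

    contradict : ¬ φ≤ f B A T A
    contradict (inj₁ drop≡0) = drop≢0 (subst (λ z → f A ∸ z ≡ 0) fT≡fB drop≡0)
    contradict (inj₂ (_ , le)) = <⇒≱ smaller
      (*-cancelʳ-≤ _ _ (f A ∸ f B) {{≢-nonZero drop≢0}}
        (subst (λ z → (∣ A ∣ ∸ ∣ B ∣) * (f A ∸ z) ≤ (∣ A ∣ ∸ ∣ T ∣) * (f A ∸ f B)) fT≡fB le))

module Polymatroid {n : ℕ} {f : SetFn n} (P : IsPolymatroid f) where
  open IsPolymatroid P

  ∈⇒InSpan : ∀ {A : Subset n} {e : Fin n} → e ∈ A → InSpan f A e
  ∈⇒InSpan e∈A = ≤-antisym (monotone (∪-least ⊆-refl (x∈p⇒⁅x⁆⊆p e∈A))) (monotone (p⊆p∪q _))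

  InSpan-mono : ∀ {A B : Subset n} {e : Fin n} → A ⊆ B → InSpan f A e → InSpan f B e
  InSpan-mono {A} {B} {e} A⊆B e∈spanA = ≤-antisym (+-cancelʳ-≤ (f A) _ _ bound) (monotone (p⊆p∪q _))
    where
      open ≤-Reasoning
      bound : f (B ∪ ⁅ e ⁆) + f A ≤ f B + f A
      bound = begin
        f (B ∪ ⁅ e ⁆) + f A
          ≤⟨ +-mono-≤ (monotone (∪-least (p⊆p∪q _) (λ x∈ → q⊆p∪q B _ (q⊆p∪q A _ x∈))))
                      (monotone (λ x∈A → x∈p∩q⁺ (A⊆B x∈A , p⊆p∪q _ x∈A))) ⟩
        f (B ∪ (A ∪ ⁅ e ⁆)) + f (B ∩ (A ∪ ⁅ e ⁆))
          ≤⟨ submodular B (A ∪ ⁅ e ⁆) ⟩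
        f B + f (A ∪ ⁅ e ⁆)
          ≡⟨ cong (f B +_) e∈spanA ⟩
        f B + f A ∎

  span⊆⇒Closed : ∀ {A : Subset n} → (∀ {e} → InSpan f A e → e ∈ A) → Closed f A
  span⊆⇒Closed span⊆A e = mk⇔ span⊆A ∈⇒InSpan

module StrengthDecomposition
    {n : ℕ} {f : SetFn n} (P : IsPolymatroid f) (pos : ∀ (e : Fin n) → 0 < f ⁅ e ⁆)
    {w : ℕ} {S : ℕ → Subset n} (D : IsStrengthDecomposition f w S) where
  open IsPolymatroid P
  open IsStrengthDecomposition D
  open Polymatroid P

  f-S≢0 : ∀ {j} → j < w → f (S j) ≢ 0
  f-S≢0 j<w fSj≡0 with nonempty _ j<w
  ... | x , x∈Sj = <⇒≱ (pos x) (subst (f ⁅ x ⁆ ≤_) fSj≡0 (monotone (x∈p⇒⁅x⁆⊆p x∈Sj)))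

  -- Comparing with T = ∅, whose φ is finite because f(S_j) > 0.
  rank-drop≢0 : ∀ {j} → j < w → f (S j) ∸ f (S (suc j)) ≢ 0
  rank-drop≢0 {j} j<w with minimal j j<w ⊥ ⊥⊆
  ... | inj₁ drop∅≡0 = λ _ → f-S≢0 j<w (subst (λ z → f (S j) ∸ z ≡ 0) empty0 drop∅≡0)
  ... | inj₂ (drop≢0 , _) = drop≢0

  layer-unspanned : ∀ {j e} → j < w → e ∈ S j → e ∉ S (suc j) → ¬ InSpan f (S (suc j)) e
  layer-unspanned {j} {e} j<w e∈Sj e∉Sj+1 e∈span =
    φ≰-equal-rank-superset f Sj+1⊂T T⊆Sj e∈span (rank-drop≢0 j<w) (minimal j j<w T T⊆Sj)
    where
      T : Subset n
      T = S (suc j) ∪ ⁅ e ⁆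

      Sj+1⊂T : S (suc j) ⊂ T
      Sj+1⊂T = p⊆p∪q _ , e , q⊆p∪q _ _ (x∈⁅x⁆ e) , e∉Sj+1

      T⊆Sj : T ⊆ S j
      T⊆Sj = ∪-least (sub j j<w) (x∈p⇒⁅x⁆⊆p e∈Sj)

  InSpan⇒∈ : ∀ i → i ≤ w → ∀ {e} → InSpan f (S i) e → e ∈ S i
  InSpan⇒∈ zero _ _ = subst (_ ∈_) (sym first) ∈⊤
  InSpan⇒∈ (suc j) j<w {e} e∈span with e ∈? S (suc j)
  ... | yes e∈Sj+1 = e∈Sj+1
  ... | no e∉Sj+1 = ⊥-elim (layer-unspanned j<w
          (InSpan⇒∈ j (<⇒≤ j<w) (InSpan-mono (sub j j<w) e∈span)) e∉Sj+1 e∈span)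

lemma4p4 : ∀ {n : ℕ} (f : SetFn n) → IsPolymatroid f
         → (∀ (e : Fin n) → 0 < f ⁅ e ⁆)
         → ∀ (w : ℕ) (S : ℕ → Subset n) → IsStrengthDecomposition f w S
         → ∀ (i : ℕ) → i ≤ w → Closed f (S i)
lemma4p4 f P pos w S D i i≤w =
  Polymatroid.span⊆⇒Closed P (StrengthDecomposition.InSpan⇒∈ P pos D i i≤w)
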